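{- Let $f:(A,P_A)\to(B,P_B)$ be a regular epimorphism in $\mathsf{PoSet}$. Then $f$ is surjective on the cover relation of $P_B$: for every $(b,b')\in\mathrm{TrRd}(P_B)$ there is $(a,a')\in P_A$ with $f(a)=b$ and $f(a')=b'$.
   Context: $\mathsf{PoSet}$ is the category of finite sets with a strict partial order (asymmetric, transitive relation) and strictly order-preserving maps. A regular epimorphism is a morphism that is the coequalizer of some parallel pair of morphisms. For a finite strict partial order $P_B$ on $B$, $\mathrm{TrRd}(P_B)$ (transitive reduction, i.e. cover relation) is the smallest subset $S\subseteq P_B$ whose transitive closure is $P_B$; equivalently, the pairs $(b,b')\in P_B$ with no $c$ such that $(b,c),(c,b')\in P_B$. -}

module Defs where

open import Level using (0ℓ)
open import Data.Nat using (ℕ)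
open import Data.Fin using (Fin)
open import Data.Product using (Σ; _×_; _,_; proj₁; proj₂; ∃)
open import Data.Empty using (⊥)
open import Relation.Nullary using (¬_)
open import Relation.Binary.PropositionalEquality using (_≡_)

record IsStrictPO {n : ℕ} (R : Fin n → Fin n → Set) : Set where
  field
    asym  : ∀ {x y} → R x y → ¬ R y x
    trans : ∀ {x y z} → R x y → R y z → R x z

record PoSet : Set₁ where
  constructor poset
  field
    size  : ℕ
    rel   : Fin size → Fin size → Set
    isSPO : IsStrictPO rel

  Carrier : Set
  Carrier = Fin size

open PoSet public

record Hom (X Y : PoSet) : Set where
  constructor hom
  field
    fun  : Carrier X → Carrier Y
    mono : ∀ {x x'} → rel X x x' → rel Y (fun x) (fun x')

open Hom public

_∘H_ : ∀ {X Y Z} → Hom Y Z → Hom X Y → Hom X Z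
g ∘H f = hom (λ x → fun g (fun f x)) (λ r → mono g (mono f r))

_≈H_ : ∀ {X Y} → Hom X Y → Hom X Y → Set
f ≈H g = ∀ x → fun f x ≡ fun g x

record IsCoequalizer {C A B : PoSet} (g h : Hom C A) (f : Hom A B) : Set₁ where
  field
    equalizes : (f ∘H g) ≈H (f ∘H h)
    universal : ∀ (D : PoSet) (k : Hom A D) → (k ∘H g) ≈H (k ∘H h) →
                Σ (Hom B D) λ u → ((u ∘H f) ≈H k) ×
                  (∀ (u' : Hom B D) → (u' ∘H f) ≈H k → u' ≈H u)

IsRegularEpi : ∀ {A B : PoSet} → Hom A B → Set₁
IsRegularEpi {A} {B} f =
  Σ PoSet λ C → Σ (Hom C A) λ g → Σ (Hom C A) λ h → IsCoequalizer g h f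

TrRd : (B : PoSet) → Carrier B → Carrier B → Set
TrRd B b b' = rel B b b' × (¬ Σ (Carrier B) λ c → rel B b c × rel B c b')

{-# OPTIONS --safe #-}
module Submission where

-- P_B is the least transitive subrelation of itself containing the image of
-- P_A: any such R makes (B, R) a poset through which f factors, and since a
-- coequalizer is epic the factorization is the identity on points, so it
-- carries P_B into R.  For a cover (b, b′), take R x y := "x < y, and if
-- (x, y) = (b, b′) it has a preimage in P_A"; R is transitive because a
-- composite pair is never a cover.

open import Defs
open import Data.Product using (Σ; _×_; _,_; proj₁; proj₂)
open import Data.Empty using (⊥-elim)
open import Relation.Binary.Core using (_⇒_)
open import Relation.Binary.Definitions using (Transitive)
open import Relation.Binary.PropositionalEquality
  using (_≡_; refl; sym; trans; cong; subst₂)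

module _ {C A B : PoSet} {g h : Hom C A} {f : Hom A B}
         (coeq : IsCoequalizer g h f) where

  open IsCoequalizer coeq

  coequalizer-epic : ∀ {D} (u v : Hom B D) → (u ∘H f) ≈H (v ∘H f) → u ≈H v
  coequalizer-epic {D} u v uf≈vf x = trans (u≈w x) (sym (v≈w x))
    where
    factors : ((u ∘H f) ∘H g) ≈H ((u ∘H f) ∘H h)
    factors c = cong (fun u) (equalizes c)
    w = universal D (u ∘H f) factors
    u≈w = proj₂ (proj₂ w) u (λ _ → refl)
    v≈w = proj₂ (proj₂ w) v (λ a → sym (uf≈vf a))

  coequalizer-rel-least : (R : Carrier B → Carrier B → Set) →
    R ⇒ rel B → Transitive R →
    (∀ {a a'} → rel A a a' → R (fun f a) (fun f a')) →
    rel B ⇒ R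
  coequalizer-rel-least R R⊆rel R-trans image {x} {y} x<y =
    subst₂ R (u≈id x) (u≈id y) (mono u x<y)
    where
    D : PoSet
    D = poset (size B) R record
      { asym  = λ p q → IsStrictPO.asym (isSPO B) (R⊆rel p) (R⊆rel q)
      ; trans = R-trans
      }
    f′ : Hom A D
    f′ = hom (fun f) image
    factorization = universal D f′ equalizes
    u = proj₁ factorization
    inclusion : Hom D B
    inclusion = hom (λ z → z) R⊆rel
    identity : Hom B B
    identity = hom (λ z → z) (λ r → r)
    u≈id : (inclusion ∘H u) ≈H identity
    u≈id = coequalizer-epic (inclusion ∘H u) identity (proj₁ (proj₂ factorization))

lemmaA20 : ∀ {A B : PoSet} (f : Hom A B) → IsRegularEpi f →
    ∀ (b b' : Carrier B) → TrRd B b b' →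
    Σ (Carrier A) λ a → Σ (Carrier A) λ a' →
      rel A a a' × (fun f a ≡ b) × (fun f a' ≡ b')
lemmaA20 {A} {B} f (_ , _ , _ , coeq) b b' (b<b' , nothing-between) =
  proj₂ (coequalizer-rel-least coeq R proj₁ R-trans image b<b') refl refl
  where
  Lifts : Carrier B → Carrier B → Set
  Lifts x y = x ≡ b → y ≡ b' →
    Σ (Carrier A) λ a → Σ (Carrier A) λ a' →
      rel A a a' × (fun f a ≡ x) × (fun f a' ≡ y)
  R : Carrier B → Carrier B → Set
  R x y = rel B x y × Lifts x y
  R-trans : Transitive R
  R-trans {j = y} (p , _) (q , _) =
    IsStrictPO.trans (isSPO B) p q , λ { refl refl → ⊥-elim (nothing-between (y , p , q)) }
  image : ∀ {a a'} → rel A a a' → R (fun f a) (fun f a')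
  image {a} {a'} r = mono f r , λ _ _ → a , a' , r , refl , refl
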